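{- Let $M$ and $M'$ be $n$-layered models over a signature $\Delta^n$ and let $B=(B_k)_{k\in\{0,\dots,n\}}$ be an $n$-layered bisimulation between $M$ and $M'$. Then for every $k\in\{0,\dots,n\}$, every $(w_0,\dots,w_k)$ and $(w'_0,\dots,w'_k)$ with $(w_0,\dots,w_k)B_k(w'_0,\dots,w'_k)$, and every $\varphi\in SFm(k,\Delta^n)$, \[M_k,w_0,\dots,w_k\models_k\varphi\quad\text{iff}\quad M'_k,w'_0,\dots,w'_k\models_k\varphi.\]
   Context: Notation. For $P\subseteq S_0\times\dots\times S_n$ and $k\le n$, $P|_k\subseteq S_0\times\dots\times S_k$ is the set of $(s_0,\dots,s_k)$ such that $(s_0,\dots,s_n)\in P$ for some $s_{k+1},\dots,s_n$. Signatures. An $n$-layered signature $\Delta^n=(\mathrm{Prop}_k,\mathrm{Nom}_k)_{k\in\{0,\dots,n\}}$ is a family of pairwise disjoint, possibly empty, sets of propositions $p_k\in\mathrm{Prop}_k$ and nominals $i_k\in\mathrm{Nom}_k$. Strict formulas. For $k\in\{0,\dots,n\}$, $SFm(k,\Delta^n)$ is the set of formulas generated by $\varphi::= p_k\mid i_k\mid\neg\varphi\mid\varphi\wedge\varphi\mid @_{i_k}\varphi\mid\Diamond_k\varphi$ with $p_k\in\mathrm{Prop}_k$, $i_k\in\mathrm{Nom}_k$. Models. An $n$-layered model $M=(W^n,D^n,R^n,V^n)$ over $\Delta^n$ consists of: pairwise disjoint sets $W_0,\dots,W_n$; a predicate $D^n\subseteq W_0\times\dots\times W_n$ such that, writing $D_k=D^n|_k$,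 for each $k$, $W_k=\{v_k\mid (w_0,\dots,w_{k-1},v_k)\in D_k\text{ for some }(w_0,\dots,w_{k-1})\in D_{k-1}\}$; relations $R_k\subseteq D_k\times D_k$ ($k\le n$); valuations $V^{\mathrm{Prop}}_0:\mathrm{Prop}_0\to\mathcal P(W_0)$, $V^{\mathrm{Prop}}_k:\mathrm{Prop}_k\times D_{k-1}\to\mathcal P(W_k)$ for $k\ge1$, and $V^{\mathrm{Nom}}_k:\mathrm{Nom}_k\to W_k$. The $k$-restriction $M_k$ keeps only the components of levels $\le k$ (with $D_k$ in place of $D^n$). Primed symbols ($W'_k,D'_k,R'_k,V'$) denote the components of $M'$. Satisfaction of strict formulas. For $(w_0,\dots,w_k)\in D_k$: - $p_k$: holds iff $w_0\in V^{\mathrm{Prop}}_0(p_0)$ when $k=0$, and iff $w_k\in V^{\mathrm{Prop}}_k(p_k,(w_0,\dots,w_{k-1}))$ when $k\ge1$; - $i_k$: iff $w_k=V^{\mathrm{Nom}}_k(i_k)$ and $(w_0,\dots,w_{k-1},V^{\mathrm{Nom}}_k(i_k))\in D_k$; - $\neg,\wedge$: as usual; - $@_{i_k}\varphi$: iff $(w_0,\dots,w_{k-1},V^{\mathrm{Nom}}_k(i_k))\in D_k$ and $M_k,w_0,\dots,w_{k-1},V^{\mathrm{Nom}}_k(i_k)\models_k\varphi$; - $\Diamond_k\varphi$: iff there is $(v_0,\dots,v_k)$ with $(w_0,\dots,w_k)R_k(v_0,\dots,v_k)$ and $M_k,v_0,\dots,v_k\models_k\varphi$. $n$-layered bisimulation.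 A family $B=(B_k\subseteq D_k\times D'_k)_{k\in\{0,\dots,n\}}$ is an $n$-layered bisimulation between $M$ and $M'$ if for every $k$ and every $(w_0,\dots,w_k)B_k(w'_0,\dots,w'_k)$: (ATOM$_k$) 1. for each $p_k\in\mathrm{Prop}_k$: if $k=0$, $w_0\in V^{\mathrm{Prop}}_0(p_0)$ iff $w'_0\in V'^{\mathrm{Prop}}_0(p_0)$; if $k\ge1$, $w_k\in V^{\mathrm{Prop}}_k(p_k,(w_0,\dots,w_{k-1}))$ iff $w'_k\in V'^{\mathrm{Prop}}_k(p_k,(w'_0,\dots,w'_{k-1}))$. 2. for each $i_k\in\mathrm{Nom}_k$: (i) if $k=0$, $V^{\mathrm{Nom}}_0(i_0)\,B_0\,V'^{\mathrm{Nom}}_0(i_0)$; if $k\ge1$, $(w_0,\dots,w_{k-1},V^{\mathrm{Nom}}_k(i_k))\,B_k\,(w'_0,\dots,w'_{k-1},V'^{\mathrm{Nom}}_k(i_k))$; (ii) [$w_k=V^{\mathrm{Nom}}_k(i_k)$ and $(w_0,\dots,w_{k-1},V^{\mathrm{Nom}}_k(i_k))\in D_k$] iff [$w'_k=V'^{\mathrm{Nom}}_k(i_k)$ and $(w'_0,\dots,w'_{k-1},V'^{\mathrm{Nom}}_k(i_k))\in D'_k$]. (ZIG$_k$) for all $(v_0,\dots,v_k)$ with $(w_0,\dots,w_k)R_k(v_0,\dots,v_k)$ there is $(v'_0,\dots,v'_k)$ with $(w'_0,\dots,w'_k)R'_k(v'_0,\dots,v'_k)$ and $(v_0,\dots,v_k)B_k(v'_0,\dots,v'_k)$.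 (ZAG$_k$) for all $(v'_0,\dots,v'_k)$ with $(w'_0,\dots,w'_k)R'_k(v'_0,\dots,v'_k)$ there is $(v_0,\dots,v_k)$ with $(w_0,\dots,w_k)R_k(v_0,\dots,v_k)$ and $(v_0,\dots,v_k)B_k(v'_0,\dots,v'_k)$. -}

module Defs where

open import Data.Nat using (ℕ; zero; suc; _≤_)
open import Data.Unit using (⊤; tt)
open import Data.Product using (Σ; _×_; _,_)
open import Relation.Nullary using (¬_)
open import Relation.Binary.PropositionalEquality using (_≡_)
open import Function.Bundles using (_⇔_)

-- Disjointness of the various sets is automatic since they
-- are distinct types indexed by the layer.  (Layers k > n are ignored.)
record Signature : Set₁ where
  field
    Prop : ℕ → Set
    Nom  : ℕ → Set

open Signature public

-- Tuples (w₀,…,w_k) ∈ W₀ × … × W_k, written as (context , last component),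
-- where the context of layer 0 is trivial and the context of layer k+1 is a
-- tuple of layer k.
mutual
  Ctx : (ℕ → Set) → ℕ → Set
  Ctx W zero    = ⊤
  Ctx W (suc k) = Tup W k

  Tup : (ℕ → Set) → ℕ → Set
  Tup W k = Ctx W k × W k

-- Pre W t m s : the k-tuple t is the restriction (prefix) of the m-tuple s.
data Pre (W : ℕ → Set) {k : ℕ} (t : Tup W k) : (m : ℕ) → Tup W m → Set where
  here  : Pre W t k t
  there : ∀ {m} {s : Tup W m} → Pre W t m s → (w : W (suc m)) →
          Pre W t (suc m) (s , w)

Restr : (W : ℕ → Set) (n : ℕ) → (Tup W n → Set) → (k : ℕ) → Tup W k → Set
Restr W n D k t = Σ (Tup W n) λ s → D s × Pre W t n s

CtxIn : (W : ℕ → Set) (n : ℕ) → (Tup W n → Set) → (k : ℕ) → Ctx W k → Set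
CtxIn W n D zero    c = ⊤
CtxIn W n D (suc k) c = Restr W n D k c

record Model (Δ : Signature) (n : ℕ) : Set₁ where
  field
    W   : ℕ → Set
    D   : Tup W n → Set
  Dk : (k : ℕ) → Tup W k → Set
  Dk = Restr W n D
  field
    W-cover : ∀ k → k ≤ n → (v : W k) →
              Σ (Ctx W k) λ c → CtxIn W n D k c × Dk k (c , v)
    R     : (k : ℕ) → Tup W k → Tup W k → Set
    R⊆D   : ∀ k → k ≤ n → ∀ t u → R k t u → Dk k t × Dk k u
    -- propositional valuation: V_0 : Prop_0 → P(W_0) (context trivial),
    -- V_k : Prop_k × D_{k-1} → P(W_k) (only values on D_{k-1} matter)
    VProp : (k : ℕ) → Prop Δ k → Ctx W k → W k → Set
    VNom  : (k : ℕ) → Nom Δ k → W k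

data SFm (Δ : Signature) (k : ℕ) : Set where
  prop : Prop Δ k → SFm Δ k
  nom  : Nom Δ k → SFm Δ k
  ¬'_  : SFm Δ k → SFm Δ k
  _∧'_ : SFm Δ k → SFm Δ k → SFm Δ k
  at   : Nom Δ k → SFm Δ k → SFm Δ k
  ◇    : SFm Δ k → SFm Δ k

-- The k-restriction M_k has exactly the
-- layer ≤ k data of M (and D_k as top predicate, whose restrictions are the
-- D_j of M), so it is computed from M directly.
module _ {Δ : Signature} {n : ℕ} (M : Model Δ n) where
  open Model M

  sat : (k : ℕ) → Tup W k → SFm Δ k → Set
  sat k (c , w) (prop p)  = VProp k p c w
  sat k (c , w) (nom i)   = (w ≡ VNom k i) × Dk k (c , VNom k i)
  sat k t       (¬' φ)    = ¬ sat k t φ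
  sat k t       (φ ∧' ψ)  = sat k t φ × sat k t ψ
  sat k (c , w) (at i φ)  = Dk k (c , VNom k i) × sat k (c , VNom k i) φ
  sat k t       (◇ φ)     = Σ (Tup W k) λ u → R k t u × sat k u φ

record Bisimulation {Δ : Signature} {n : ℕ} (M M' : Model Δ n) : Set₁ where
  private
    module M  = Model M
    module M' = Model M'
  field
    B     : (k : ℕ) → Tup M.W k → Tup M'.W k → Set
    B⊆D   : ∀ k → k ≤ n → ∀ t t' → B k t t' → M.Dk k t × M'.Dk k t'
    atom-prop : ∀ k → k ≤ n → ∀ c w c' w' → B k (c , w) (c' , w') →
                (p : Prop Δ k) → M.VProp k p c w ⇔ M'.VProp k p c' w'
    atom-nom-i : ∀ k → k ≤ n → ∀ c w c' w' → B k (c , w) (c' , w') →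
                 (i : Nom Δ k) → B k (c , M.VNom k i) (c' , M'.VNom k i)
    atom-nom-ii : ∀ k → k ≤ n → ∀ c w c' w' → B k (c , w) (c' , w') →
                  (i : Nom Δ k) →
                  ((w ≡ M.VNom k i) × M.Dk k (c , M.VNom k i)) ⇔
                  ((w' ≡ M'.VNom k i) × M'.Dk k (c' , M'.VNom k i))
    zig : ∀ k → k ≤ n → ∀ t t' → B k t t' → ∀ u → M.R k t u →
          Σ (Tup M'.W k) λ u' → M'.R k t' u' × B k u u'
    zag : ∀ k → k ≤ n → ∀ t t' → B k t t' → ∀ u' → M'.R k t' u' →
          Σ (Tup M.W k) λ u → M.R k t u × B k u u'

-- Each clause of the
-- satisfaction relation is matched by one clause of the bisimulation: ATOM(1)
-- for propositions, ATOM(2)(ii) for nominals, ATOM(2)(i) together with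
-- B_k ⊆ D_k × D'_k for @_i, and ZIG/ZAG for ◇_k; the Boolean connectives are
-- congruences of ⇔.
module Submission where

open import Defs
open import Level using (Level)
open import Data.Nat using (ℕ; _≤_)
open import Data.Product using (∃; _×_; _,_; proj₁; proj₂)
open import Data.Product.Function.NonDependent.Propositional using (_×-⇔_)
open import Function using (const)
open import Function.Bundles using (_⇔_; mk⇔; module Equivalence)
open import Function.Related.TypeIsomorphisms using (¬-cong-⇔)

private
  variable
    a b ℓ : Level

inhabited-⇔ : {A : Set a} {B : Set b} → A → B → A ⇔ B
inhabited-⇔ x y = mk⇔ (const y) (const x)

◇-cong-⇔ : {X : Set a} {X' : Set a} {R : X → Set ℓ} {R' : X' → Set ℓ}
           {Z : X → X' → Set ℓ} {P : X → Set b} {P' : X' → Set b} →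
           (∀ u → R u → ∃ λ u' → R' u' × Z u u') →
           (∀ u' → R' u' → ∃ λ u → R u × Z u u') →
           (∀ {u u'} → Z u u' → P u ⇔ P' u') →
           (∃ λ u → R u × P u) ⇔ (∃ λ u' → R' u' × P' u')
◇-cong-⇔ zig zag P⇔P' = mk⇔
  (λ (u , r , p) → let u' , r' , z = zig u r in u' , r' , Equivalence.to (P⇔P' z) p)
  (λ (u' , r' , p') → let u , r , z = zag u' r' in u , r , Equivalence.from (P⇔P' z) p')

module _ {Δ : Signature} {n : ℕ} {M M' : Model Δ n} (Bis : Bisimulation M M')
         (k : ℕ) (k≤n : k ≤ n) where
  open Bisimulation Bis

  B-preserves-sat : ∀ {t t'} → B k t t' → (φ : SFm Δ k) → sat M k t φ ⇔ sat M' k t' φ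
  B-preserves-sat {c , w} {c' , w'} b (prop p) = atom-prop k k≤n c w c' w' b p
  B-preserves-sat {c , w} {c' , w'} b (nom i)  = atom-nom-ii k k≤n c w c' w' b i
  B-preserves-sat b (¬' φ)   = ¬-cong-⇔ (B-preserves-sat b φ)
  B-preserves-sat b (φ ∧' ψ) = B-preserves-sat b φ ×-⇔ B-preserves-sat b ψ
  B-preserves-sat {c , w} {c' , w'} b (at i φ) =
    inhabited-⇔ (proj₁ named∈D) (proj₂ named∈D) ×-⇔ B-preserves-sat named φ
    where
    named : B k (c , Model.VNom M k i) (c' , Model.VNom M' k i)
    named = atom-nom-i k k≤n c w c' w' b i
    named∈D : Model.Dk M k (c , Model.VNom M k i) × Model.Dk M' k (c' , Model.VNom M' k i)
    named∈D = B⊆D k k≤n _ _ named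
  B-preserves-sat {t} {t'} b (◇ φ) =
    ◇-cong-⇔ (zig k k≤n t t' b) (zag k k≤n t t' b) (λ z → B-preserves-sat z φ)

theorem2 : {Δ : Signature} {n : ℕ} (M M' : Model Δ n) (Bis : Bisimulation M M')
    (k : ℕ) → k ≤ n →
    (t : Tup (Model.W M) k) (t' : Tup (Model.W M') k) →
    Bisimulation.B Bis k t t' →
    (φ : SFm Δ k) → sat M k t φ ⇔ sat M' k t' φ
theorem2 M M' Bis k k≤n t t' = B-preserves-sat Bis k k≤n
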